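{- For any positive integers $p$ and $q$ satisfying $3\le \frac{p}{q}<\frac72$, there is a $4$-critical graph $G$ with no $(p,q)$-colouring satisfying $e(G)<\frac{27v(G)-20}{15}$.
   Context: A graph is $4$-critical if its chromatic number is $4$ but every proper subgraph is $3$-colourable. For positive integers $p,q$ with $p/q\ge2$, a $(p,q)$-colouring of $G$ is a map $f:V(G)\to\{0,\dots,p-1\}$ with $q\le|f(u)-f(v)|\le p-q$ for every edge $uv$. $v(G)$, $e(G)$ are the numbers of vertices and edges. -}

module Defs where

open import Data.Nat using (ℕ; _+_; _*_; _≤_; _<_; _<ᵇ_; ∣_-_∣; _∸_)
open import Data.Bool using (Bool; true; false; if_then_else_; _∧_)
open import Data.Fin using (Fin; toℕ)
open import Data.List using (map; allFin)
open import Data.Nat.ListAction using (sum)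
open import Data.Product using (Σ; _×_)
open import Relation.Nullary using (¬_)
open import Relation.Binary.PropositionalEquality using (_≡_; _≢_)

record Graph : Set where
  field
    n     : ℕ
    adj   : Fin n → Fin n → Bool
    sym   : ∀ i j → adj i j ≡ adj j i
    irr   : ∀ i → adj i i ≡ false

open Graph public

v : Graph → ℕ
v G = n G

e : Graph → ℕ
e G = sum (map (λ i → sum (map (λ j → if (toℕ i <ᵇ toℕ j) ∧ adj G i j then 1 else 0)
                               (allFin (n G))))
               (allFin (n G)))

Colourable : ℕ → Graph → Set
Colourable k G = Σ (Fin (n G) → Fin k) λ c → ∀ i j → adj G i j ≡ true → c i ≢ c j

ChromaticNumber : Graph → ℕ → Set
ChromaticNumber G k = Colourable k G × (∀ m → m < k → ¬ Colourable m G)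

record Subgraph (G : Graph) : Set where
  field
    S      : Fin (n G) → Bool
    E      : Fin (n G) → Fin (n G) → Bool
    E-sym  : ∀ i j → E i j ≡ E j i
    E-sub  : ∀ i j → E i j ≡ true → adj G i j ≡ true
    E-ends : ∀ i j → E i j ≡ true → S i ≡ true

open Subgraph public

Proper : {G : Graph} → Subgraph G → Set
Proper {G} H = ¬ ((∀ i → S H i ≡ true) × (∀ i j → E H i j ≡ adj G i j))

SubColourable : ℕ → {G : Graph} → Subgraph G → Set
SubColourable k {G} H =
  Σ ((i : Fin (n G)) → S H i ≡ true → Fin k) λ c →
    ∀ i j (Ei : S H i ≡ true) (Ej : S H j ≡ true) → E H i j ≡ true → c i Ei ≢ c j Ej

FourCritical : Graph → Set
FourCritical G = ChromaticNumber G 4 × (∀ (H : Subgraph G) → Proper H → SubColourable 3 H)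

PQColouring : ℕ → ℕ → Graph → Set
PQColouring p q G =
  Σ (Fin (n G) → ℕ) λ f →
    (∀ i → f i < p) ×
    (∀ i j → adj G i j ≡ true → (q ≤ ∣ f i - f j ∣) × (∣ f i - f j ∣ ≤ p ∸ q))

-- The witness is the Moser spindle: two rhombi (pairs of triangles sharing an edge)
-- with a common apex and their far tips joined; it has 7 vertices and 11 edges, and
-- 15·11 + 20 < 27·7. Criticality is checked by exhibiting a 3-colouring of G − e for
-- every edge e.
-- A (p,q)-colouring places the vertices on the cycle ℤ_p so that adjacent vertices are
-- at circular distance at least q; rotate it so that the apex sits at 0. The two middle
-- vertices of a rhombus are at distance ≥ q from 0 and from each other, and as p < 4q
-- this forces the tip, adjacent to both, within distance p − 3q of 0. The two tips are
-- then within 2(p − 3q) < q of each other (as 2p < 7q), yet they are adjacent.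
-- Since a 3-colouring c yields the (p,q)-colouring q·c, the spindle is not 3-colourable
-- either.

module Submission where

open import Defs
open import Data.Nat using (ℕ; _+_; _*_; _≤_; _<_)
open import Data.Product using (Σ; _×_)
open import Relation.Nullary using (¬_)

open import Data.Bool using (Bool; true; false; if_then_else_; _∧_; _∨_)
import Data.Bool.Properties as Bool
open import Data.Bool.ListAction using (any)
open import Data.Empty using (⊥; ⊥-elim)
open import Data.Fin using (Fin; toℕ; inject≤)
open import Data.Fin.Patterns
open import Data.Fin.Properties using (all?; any?; toℕ<n; toℕ-inject≤; toℕ-injective)
import Data.Fin.Properties as Fin
open import Data.List using (List; []; _∷_)
open import Data.Nat using (suc; _∸_; ∣_-_∣; s≤s⁻¹; NonZero; >-nonZero)
open import Data.Nat.Properties hiding (_≟_)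
open import Algebra.Properties.CommutativeSemigroup +-commutativeSemigroup using (xy∙z≈xz∙y)
open import Data.Nat.Tactic.RingSolver using (solve-∀)
open import Data.Product using (∃; ∃₂; _,_; proj₁; proj₂)
open import Data.Sum using (_⊎_; inj₁; inj₂)
import Data.Sum as Sum
open import Data.Vec using (Vec; _∷_; []; lookup; replicate)
open import Function using (_∘_)
open import Relation.Nullary using (yes; no; contradiction)
open import Relation.Nullary.Decidable using (Dec; ¬?; ⌊_⌋; from-yes; _→-dec_; _×-dec_; _⊎-dec_)
open import Relation.Binary.PropositionalEquality hiding (sym)
open import Relation.Binary.PropositionalEquality as ≡ using ()

module _ {G : Graph} where

  colourable-≤ : ∀ {m k} → m ≤ k → Colourable m G → Colourable k G
  colourable-≤ m≤k (c , proper) =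
    (λ i → inject≤ (c i) m≤k) ,
    λ i j ij ci≡cj → proper i j ij (toℕ-injective (begin
      toℕ (c i)               ≡⟨ toℕ-inject≤ (c i) m≤k ⟨
      toℕ (inject≤ (c i) m≤k) ≡⟨ cong toℕ ci≡cj ⟩
      toℕ (inject≤ (c j) m≤k) ≡⟨ toℕ-inject≤ (c j) m≤k ⟩
      toℕ (c j)               ∎))
    where open ≡-Reasoning

  chromaticNumber : ∀ {k} → Colourable (suc k) G → ¬ Colourable k G → ChromaticNumber G (suc k)
  chromaticNumber col ¬col = col , λ m m<1+k → ¬col ∘ colourable-≤ (s≤s⁻¹ m<1+k)

  colourable⇒pqColouring : ∀ {k p q} → 0 < q → k * q ≤ p → Colourable k G → PQColouring p q G
  colourable⇒pqColouring {k} {p} {q} 0<q kq≤p (c , proper) = f , f<p , f-apart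
    where
    instance
      q≢0 : NonZero q
      q≢0 = >-nonZero 0<q
    f : Fin (n G) → ℕ
    f i = toℕ (c i) * q
    f<p : ∀ i → f i < p
    f<p i = <-≤-trans (*-monoˡ-< q (toℕ<n (c i))) kq≤p
    f-apart : ∀ i j → adj G i j ≡ true → q ≤ ∣ f i - f j ∣ × ∣ f i - f j ∣ ≤ p ∸ q
    f-apart i j ij rewrite ≡.sym (*-distribʳ-∣-∣ q (toℕ (c i)) (toℕ (c j))) =
      m≤n*m q d {{>-nonZero 0<d}} ,
      m+n≤o⇒m≤o∸n (d * q) (subst (_≤ p) (+-comm q (d * q)) (≤-trans (*-monoˡ-≤ q d<k) kq≤p))
      where
      d : ℕ
      d = ∣ toℕ (c i) - toℕ (c j) ∣
      0<d : 0 < d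
      0<d = n≢0⇒n>0 (proper i j ij ∘ toℕ-injective ∘ ∣m-n∣≡0⇒m≡n)
      d<k : d < k
      d<k = ≤-<-trans (∣m-n∣≤m⊔n (toℕ (c i)) (toℕ (c j)))
                      (⊔-lub (toℕ<n (c i)) (toℕ<n (c j)))

  SameEdge : (i j a b : Fin (n G)) → Set
  SameEdge i j a b = (a ≡ i × b ≡ j) ⊎ (a ≡ j × b ≡ i)

  ProperExcept : ∀ {k} → Fin (n G) → Fin (n G) → (Fin (n G) → Fin k) → Set
  ProperExcept i j c = ∀ a b → adj G a b ≡ true → c a ≡ c b → SameEdge i j a b

  subColourable-missingEdge : ∀ {k i j} {c : Fin (n G) → Fin k} → ProperExcept i j c →
                              (H : Subgraph G) → E H i j ≡ false → SubColourable k H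
  subColourable-missingEdge {c = c} proper H Eij≡false = (λ a _ → c a) , monochromatic⇒⊥
    where
    monochromatic⇒⊥ : ∀ a b _ _ → E H a b ≡ true → c a ≢ c b
    monochromatic⇒⊥ a b _ _ Eab ca≡cb with proper a b (E-sub H a b Eab) ca≡cb
    ... | inj₁ (refl , refl) with () ← trans (≡.sym Eab) Eij≡false
    ... | inj₂ (refl , refl) with () ← trans (≡.sym Eab) (trans (E-sym H a b) Eij≡false)

  NoIsolatedVertex : Set
  NoIsolatedVertex = ∀ i → ∃ λ j → adj G i j ≡ true

  proper⇒missesEdge : NoIsolatedVertex → (H : Subgraph G) → Proper H →
                      ∃₂ λ i j → adj G i j ≡ true × E H i j ≡ false
  proper⇒missesEdge noIsolated H proper
    with any? (λ i → any? λ j → adj G i j Bool.≟ true ×-dec E H i j Bool.≟ false)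
  ... | yes (i , j , missing) = i , j , missing
  ... | no ¬missing = ⊥-elim (proper (spanning , sameEdges))
    where
    contains : ∀ i j → adj G i j ≡ true → E H i j ≡ true
    contains i j ij with E H i j in Eij
    ... | true  = refl
    ... | false = ⊥-elim (¬missing (i , j , ij , Eij))
    spanning : ∀ i → S H i ≡ true
    spanning i with noIsolated i
    ... | j , ij = E-ends H i j (contains i j ij)
    sameEdges : ∀ i j → E H i j ≡ adj G i j
    sameEdges i j with adj G i j in ij
    ... | true  = contains i j ij
    ... | false with E H i j in Eij
    ...   | true  = trans (≡.sym (E-sub H i j Eij)) ij
    ...   | false = refl

  properSubgraphs-colourable :
    ∀ {k} → NoIsolatedVertex →
    (∀ i j → adj G i j ≡ true → Σ (Fin (n G) → Fin k) (ProperExcept i j)) →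
    (H : Subgraph G) → Proper H → SubColourable k H
  properSubgraphs-colourable noIsolated deletable H proper with proper⇒missesEdge noIsolated H proper
  ... | i , j , ij , Eij with deletable i j ij
  ...   | c , c-proper = subColourable-missingEdge c-proper H Eij

  properColouring? : ∀ {k} (c : Fin (n G) → Fin k) → Dec (∀ i j → adj G i j ≡ true → c i ≢ c j)
  properColouring? c = all? λ i → all? λ j → adj G i j Bool.≟ true →-dec ¬? (c i Fin.≟ c j)

  properExcept? : ∀ {k} i j (c : Fin (n G) → Fin k) → Dec (ProperExcept i j c)
  properExcept? i j c = all? λ a → all? λ b → adj G a b Bool.≟ true →-dec c a Fin.≟ c b →-dec
    ((a Fin.≟ i ×-dec b Fin.≟ j) ⊎-dec (a Fin.≟ j ×-dec b Fin.≟ i))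

module Circular (p q : ℕ) where

  private variable x y z d h hx hy : ℕ

  Apart : ℕ → ℕ → Set
  Apart x y = q ≤ ∣ x - y ∣ × ∣ x - y ∣ ≤ p ∸ q

  -- Going forward from x, y is between q and p − q steps away; the values are not reduced
  -- mod p, so this also relates a colour to the lift p + x of another.
  Ahead : ℕ → ℕ → Set
  Ahead x y = x + q ≤ y × y + q ≤ x + p

  Separated : ℕ → ℕ → Set
  Separated x y = Ahead x y ⊎ Ahead y x

  apart-sym : Apart x y → Apart y x
  apart-sym {x} {y} apart rewrite ∣-∣-comm y x = apart

  apart-+⇒ahead : q ≤ p → Apart x (x + d) → Ahead x (x + d)
  apart-+⇒ahead {x} {d} q≤p apart rewrite ∣m-m+n∣≡n x d with apart
  ... | q≤d , d≤p∸q = +-monoʳ-≤ x q≤d , (begin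
    x + d + q   ≡⟨ +-assoc x d q ⟩
    x + (d + q) ≤⟨ +-monoʳ-≤ x (m≤o∸n⇒m+n≤o d q≤p d≤p∸q) ⟩
    x + p       ∎)
    where open ≤-Reasoning

  apart⇒separated : q ≤ p → Apart x y → Separated x y
  apart⇒separated {x} {y} q≤p apart with ≤-total x y
  ... | inj₁ x≤y with _ , refl ← m≤n⇒∃[o]m+o≡n x≤y = inj₁ (apart-+⇒ahead q≤p apart)
  ... | inj₂ y≤x with _ , refl ← m≤n⇒∃[o]m+o≡n y≤x =
    inj₂ (apart-+⇒ahead q≤p (apart-sym {x} apart))

  ahead-shift : ∀ k → Ahead x y → Ahead (k + x) (k + y)
  ahead-shift {x} {y} k (x+q≤y , y+q≤x+p) =
    subst (_≤ k + y) (≡.sym (+-assoc k x q)) (+-monoʳ-≤ k x+q≤y) ,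
    subst₂ _≤_ (≡.sym (+-assoc k y q)) (≡.sym (+-assoc k x p)) (+-monoʳ-≤ k y+q≤x+p)

  ahead-unshift : ∀ k → Ahead (k + x) (k + y) → Ahead x y
  ahead-unshift {x} {y} k (kx+q≤ky , ky+q≤kx+p) =
    +-cancelˡ-≤ k _ _ (subst (_≤ k + y) (+-assoc k x q) kx+q≤ky) ,
    +-cancelˡ-≤ k _ _ (subst₂ _≤_ (+-assoc k y q) (+-assoc k x p) ky+q≤kx+p)

  ahead-wrap : Ahead x y → Ahead y (p + x)
  ahead-wrap {x} {y} (x+q≤y , y+q≤x+p) = subst (y + q ≤_) (+-comm x p) y+q≤x+p , (begin
    p + x + q   ≡⟨ +-assoc p x q ⟩
    p + (x + q) ≤⟨ +-monoʳ-≤ p x+q≤y ⟩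
    p + y       ≡⟨ +-comm p y ⟩
    y + p       ∎)
    where open ≤-Reasoning

  separated-sym : Separated x y → Separated y x
  separated-sym = Sum.swap

  separated-shift : ∀ k → Separated x y → Separated (k + x) (k + y)
  separated-shift k = Sum.map (ahead-shift k) (ahead-shift k)

  separated-unshift : ∀ k → Separated (k + x) (k + y) → Separated x y
  separated-unshift k = Sum.map (ahead-unshift k) (ahead-unshift k)

  separated-wrap : x < y → Separated x y → Separated y (p + x)
  separated-wrap x<y (inj₁ ahead) = inj₁ (ahead-wrap ahead)
  separated-wrap {x} {y} x<y (inj₂ (y+q≤x , _)) =
    contradiction (≤-trans (m≤m+n y q) y+q≤x) (<⇒≱ x<y)

  -- h is the representative in [0, p) of x − z mod p.
  Rotation : ℕ → ℕ → ℕ → Set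
  Rotation z x h = h < p × (z + h ≡ x ⊎ z + h ≡ p + x)

  rotation : z < p → x < p → ∃ (Rotation z x)
  rotation {z} {x} z<p x<p with z ≤? x
  ... | yes z≤x = x ∸ z , ≤-<-trans (m∸n≤m x z) x<p , inj₁ (m+[n∸m]≡n z≤x)
  ... | no z≰x = p + x ∸ z , +-cancelˡ-< z _ _ z+h<z+p , inj₂ z+h≡p+x
    where
    z+h≡p+x : z + (p + x ∸ z) ≡ p + x
    z+h≡p+x = m+[n∸m]≡n (≤-trans (<⇒≤ z<p) (m≤m+n p x))
    z+h<z+p : z + (p + x ∸ z) < z + p
    z+h<z+p = begin-strict
      z + (p + x ∸ z) ≡⟨ z+h≡p+x ⟩
      p + x           <⟨ +-monoʳ-< p (≰⇒> z≰x) ⟩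
      p + z           ≡⟨ +-comm p z ⟩
      z + p           ∎
      where open ≤-Reasoning

  rotation-self : Rotation z z h → h ≡ 0
  rotation-self {z} {h} (_ , inj₁ z+h≡z) = +-cancelˡ-≡ z h 0 (trans z+h≡z (≡.sym (+-identityʳ z)))
  rotation-self {z} {h} (h<p , inj₂ z+h≡p+z) =
    contradiction (+-cancelˡ-≡ z h p (trans z+h≡p+z (+-comm p z))) (<⇒≢ h<p)

  separated-rotation : Rotation z x hx → Rotation z y hy → Separated x y → Separated hx hy
  separated-rotation {z} (_ , inj₁ ex) (_ , inj₁ ey) sep =
    separated-unshift z (subst₂ Separated (≡.sym ex) (≡.sym ey) sep)
  separated-rotation {z} (_ , inj₂ ex) (_ , inj₂ ey) sep =
    separated-unshift z (subst₂ Separated (≡.sym ex) (≡.sym ey) (separated-shift p sep))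
  separated-rotation {z} {x} {hx} {y} {hy} (hx<p , inj₂ ex) (_ , inj₁ ey) sep =
    separated-unshift z
      (subst₂ Separated (≡.sym ex) (≡.sym ey) (separated-sym (separated-wrap x<y sep)))
    where
    x<y : x < y
    x<y = +-cancelˡ-< p x y (begin-strict
      p + x        ≡⟨ ex ⟨
      z + hx       <⟨ +-monoʳ-< z hx<p ⟩
      z + p        ≡⟨ +-comm z p ⟩
      p + z        ≤⟨ +-monoʳ-≤ p (m≤m+n z hy) ⟩
      p + (z + hy) ≡⟨ cong (p +_) ey ⟩
      p + y        ∎)
      where open ≤-Reasoning
  separated-rotation rx@(_ , inj₁ _) ry@(_ , inj₂ _) sep =
    separated-sym (separated-rotation ry rx (separated-sym sep))

  SeparatedColouring : (G : Graph) → (Fin (n G) → ℕ) → Set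
  SeparatedColouring G f = (∀ i → f i < p) × (∀ i j → adj G i j ≡ true → Separated (f i) (f j))

  pqColouring⇒separatedColouring : ∀ {G} → q ≤ p → PQColouring p q G → ∃ (SeparatedColouring G)
  pqColouring⇒separatedColouring q≤p (f , f<p , f-apart) =
    f , f<p , λ i j ij → apart⇒separated q≤p (f-apart i j ij)

  separatedColouring-rotate : ∀ {G f} → SeparatedColouring G f → (i₀ : Fin (n G)) →
                              ∃ λ g → SeparatedColouring G g × g i₀ ≡ 0
  separatedColouring-rotate {G} {f} (f<p , f-sep) i₀ =
    g , (proj₁ ∘ rotated , g-sep) , rotation-self (rotated i₀)
    where
    rotations : ∀ i → ∃ (Rotation (f i₀) (f i))
    rotations i = rotation (f<p i₀) (f<p i)
    g : Fin (n G) → ℕ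
    g = proj₁ ∘ rotations
    rotated : ∀ i → Rotation (f i₀) (f i) (g i)
    rotated = proj₂ ∘ rotations
    g-sep : ∀ i j → adj G i j ≡ true → Separated (g i) (g j)
    g-sep i j ij = separated-rotation (rotated i) (rotated j) (f-sep i j ij)

  apex-ahead : 0 < q → Separated 0 x → Ahead 0 x
  apex-ahead _ (inj₁ ahead) = ahead
  apex-ahead {x} 0<q (inj₂ (x+q≤0 , _)) = contradiction (≤-trans (m≤n+m q x) x+q≤0) (<⇒≱ 0<q)

  -- circular distance from 0 at most p − 3q
  Near : ℕ → Set
  Near c = c + 3 * q ≤ p ⊎ 3 * q ≤ c

  module _ (p<4q : p < 4 * q) where

    private
      4q≰p : ¬ 4 * q ≤ p
      4q≰p = <⇒≱ p<4q

      +q : ∀ {m n} → m ≤ n → m + q ≤ n + q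
      +q = +-monoˡ-≤ q

      3q≡ : ∀ q → 3 * q ≡ q + q + q
      3q≡ = solve-∀

      4q≡ : ∀ q → 4 * q ≡ q + q + q + q
      4q≡ = solve-∀

      c+3q≡ : ∀ c q → c + 3 * q ≡ c + q + q + q
      c+3q≡ = solve-∀

      3q+q≡ : ∀ q → 4 * q ≡ 3 * q + q
      3q+q≡ = solve-∀

      7q≡ : ∀ q → 7 * q ≡ 3 * q + q + 3 * q
      7q≡ = solve-∀

      2p≡ : ∀ p → 2 * p ≡ p + p
      2p≡ = solve-∀

    orderedRhombusTip-near : ∀ {a b c} → q ≤ a → b + q ≤ p → a + q ≤ b →
                             Separated c a → Separated c b → Near c
    orderedRhombusTip-near {a} {b} {c} q≤a b+q≤p a+q≤b _ (inj₂ (b+q≤c , _)) = inj₂ (begin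
      3 * q     ≡⟨ 3q≡ q ⟩
      q + q + q ≤⟨ +q (+q q≤a) ⟩
      a + q + q ≤⟨ +q a+q≤b ⟩
      b + q     ≤⟨ b+q≤c ⟩
      c         ∎)
      where open ≤-Reasoning
    orderedRhombusTip-near {a} {b} {c} q≤a b+q≤p a+q≤b (inj₁ (c+q≤a , _)) (inj₁ _) = inj₁ (begin
      c + 3 * q     ≡⟨ c+3q≡ c q ⟩
      c + q + q + q ≤⟨ +q (+q c+q≤a) ⟩
      a + q + q     ≤⟨ +q a+q≤b ⟩
      b + q         ≤⟨ b+q≤p ⟩
      p             ∎)
      where open ≤-Reasoning
    orderedRhombusTip-near {a} {b} {c} q≤a b+q≤p a+q≤b (inj₂ (a+q≤c , _)) (inj₁ (c+q≤b , _)) =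
      ⊥-elim (4q≰p (begin
      4 * q         ≡⟨ 4q≡ q ⟩
      q + q + q + q ≤⟨ +q (+q (+q q≤a)) ⟩
      a + q + q + q ≤⟨ +q (+q a+q≤c) ⟩
      c + q + q     ≤⟨ +q c+q≤b ⟩
      b + q         ≤⟨ b+q≤p ⟩
      p             ∎))
      where open ≤-Reasoning

    rhombusTip-near : ∀ {a b c} → Ahead 0 a → Ahead 0 b → Separated a b →
                      Separated c a → Separated c b → Near c
    rhombusTip-near (q≤a , _) (_ , b+q≤p) (inj₁ (a+q≤b , _)) ca cb =
      orderedRhombusTip-near q≤a b+q≤p a+q≤b ca cb
    rhombusTip-near (_ , a+q≤p) (q≤b , _) (inj₂ (b+q≤a , _)) ca cb =
      orderedRhombusTip-near q≤b a+q≤p b+q≤a cb ca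

    module _ (2p<7q : 2 * p < 7 * q) where

      near-¬ahead : Near x → Near y → y < p → ¬ Ahead x y
      near-¬ahead {x} {y} (inj₂ 3q≤x) _ y<p (x+q≤y , _) = 4q≰p (begin
        4 * q     ≡⟨ 3q+q≡ q ⟩
        3 * q + q ≤⟨ +q 3q≤x ⟩
        x + q     ≤⟨ x+q≤y ⟩
        y         ≤⟨ <⇒≤ y<p ⟩
        p         ∎)
        where open ≤-Reasoning
      near-¬ahead {x} {y} (inj₁ x+3q≤p) (inj₁ y+3q≤p) _ (x+q≤y , _) = 4q≰p (begin
        4 * q         ≡⟨ 3q+q≡ q ⟩
        3 * q + q     ≡⟨ +-comm (3 * q) q ⟩
        q + 3 * q     ≤⟨ +-monoˡ-≤ (3 * q) (m≤n+m q x) ⟩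
        x + q + 3 * q ≤⟨ +-monoˡ-≤ (3 * q) x+q≤y ⟩
        y + 3 * q     ≤⟨ y+3q≤p ⟩
        p             ∎)
        where open ≤-Reasoning
      near-¬ahead {x} {y} (inj₁ x+3q≤p) (inj₂ 3q≤y) _ (_ , y+q≤x+p) = <⇒≱ 2p<7q (begin
        7 * q             ≡⟨ 7q≡ q ⟩
        3 * q + q + 3 * q ≤⟨ +-monoˡ-≤ (3 * q) (+q 3q≤y) ⟩
        y + q + 3 * q     ≤⟨ +-monoˡ-≤ (3 * q) y+q≤x+p ⟩
        x + p + 3 * q     ≡⟨ xy∙z≈xz∙y x p (3 * q) ⟩
        x + 3 * q + p     ≤⟨ +-monoˡ-≤ p x+3q≤p ⟩
        p + p             ≡⟨ 2p≡ p ⟨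
        2 * p             ∎)
        where open ≤-Reasoning

      near-¬separated : Near x → Near y → x < p → y < p → ¬ Separated x y
      near-¬separated near-x near-y _ y<p (inj₁ ahead) = near-¬ahead near-x near-y y<p ahead
      near-¬separated near-x near-y x<p _ (inj₂ ahead) = near-¬ahead near-y near-x x<p ahead

joins : ∀ {n} → Fin n → Fin n → Fin n × Fin n → Bool
joins i j (a , b) = ⌊ i Fin.≟ a ⌋ ∧ ⌊ j Fin.≟ b ⌋ ∨ ⌊ i Fin.≟ b ⌋ ∧ ⌊ j Fin.≟ a ⌋

-- apex 0, rhombi 0123 and 0456, tips 3 and 6
spindleEdges : List (Fin 7 × Fin 7)
spindleEdges = (0F , 1F) ∷ (0F , 2F) ∷ (1F , 2F) ∷ (1F , 3F) ∷ (2F , 3F) ∷ (3F , 6F)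
             ∷ (0F , 4F) ∷ (0F , 5F) ∷ (4F , 5F) ∷ (4F , 6F) ∷ (5F , 6F) ∷ []

spindleAdj : Fin 7 → Fin 7 → Bool
spindleAdj i j = any (joins i j) spindleEdges

spindle : Graph
spindle = record
  { n   = 7
  ; adj = spindleAdj
  ; sym = from-yes (all? λ i → all? λ j → spindleAdj i j Bool.≟ spindleAdj j i)
  ; irr = from-yes (all? λ i → spindleAdj i i Bool.≟ false)
  }

spindle-4-colourable : Colourable 4 spindle
spindle-4-colourable = c , from-yes (properColouring? {spindle} c)
  where c = lookup (0F ∷ 1F ∷ 2F ∷ 0F ∷ 1F ∷ 2F ∷ 3F ∷ [])

spindle-noIsolatedVertex : NoIsolatedVertex {spindle}
spindle-noIsolatedVertex = from-yes (all? λ i → any? λ j → spindleAdj i j Bool.≟ true)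

colouringWithout : Fin 7 → Fin 7 → Fin 7 → Fin 3
colouringWithout i j = lookup (table (if ⌊ i Fin.<? j ⌋ then (i , j) else (j , i)))
  where
  table : Fin 7 × Fin 7 → Vec (Fin 3) 7
  table (0F , 1F) = 0F ∷ 0F ∷ 1F ∷ 2F ∷ 1F ∷ 2F ∷ 0F ∷ []
  table (0F , 2F) = 0F ∷ 1F ∷ 0F ∷ 2F ∷ 1F ∷ 2F ∷ 0F ∷ []
  table (1F , 2F) = 0F ∷ 1F ∷ 1F ∷ 2F ∷ 1F ∷ 2F ∷ 0F ∷ []
  table (1F , 3F) = 0F ∷ 1F ∷ 2F ∷ 1F ∷ 1F ∷ 2F ∷ 0F ∷ []
  table (2F , 3F) = 0F ∷ 1F ∷ 2F ∷ 2F ∷ 1F ∷ 2F ∷ 0F ∷ []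
  table (3F , 6F) = 0F ∷ 1F ∷ 2F ∷ 0F ∷ 1F ∷ 2F ∷ 0F ∷ []
  table (0F , 4F) = 0F ∷ 1F ∷ 2F ∷ 0F ∷ 0F ∷ 1F ∷ 2F ∷ []
  table (0F , 5F) = 0F ∷ 1F ∷ 2F ∷ 0F ∷ 1F ∷ 0F ∷ 2F ∷ []
  table (4F , 5F) = 0F ∷ 1F ∷ 2F ∷ 0F ∷ 1F ∷ 1F ∷ 2F ∷ []
  table (4F , 6F) = 0F ∷ 1F ∷ 2F ∷ 0F ∷ 1F ∷ 2F ∷ 1F ∷ []
  table (5F , 6F) = 0F ∷ 1F ∷ 2F ∷ 0F ∷ 1F ∷ 2F ∷ 2F ∷ []
  table _         = replicate 7 0F

spindle-edgeDeletions : ∀ i j → spindleAdj i j ≡ true →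
                        Σ (Fin 7 → Fin 3) (ProperExcept {spindle} i j)
spindle-edgeDeletions i j ij = colouringWithout i j , colouringWithout-proper i j ij
  where
  colouringWithout-proper : ∀ i j → spindleAdj i j ≡ true →
                            ProperExcept {spindle} i j (colouringWithout i j)
  colouringWithout-proper = from-yes (all? λ i → all? λ j →
    spindleAdj i j Bool.≟ true →-dec properExcept? {spindle} i j (colouringWithout i j))

module _ {p q : ℕ} where
  open Circular p q

  spindle-¬separatedColouring : 0 < q → p < 4 * q → 2 * p < 7 * q →
                                ∀ {g} → SeparatedColouring spindle g → g 0F ≡ 0 → ⊥
  spindle-¬separatedColouring 0<q p<4q 2p<7q {g} (g<p , g-sep) g0≡0 =
    near-¬separated p<4q 2p<7q (tip 1F 2F 3F refl refl refl refl refl)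
                               (tip 4F 5F 6F refl refl refl refl refl)
                               (g<p 3F) (g<p 6F) (g-sep 3F 6F refl)
    where
    apex : ∀ i → spindleAdj 0F i ≡ true → Ahead 0 (g i)
    apex i 0i = apex-ahead 0<q (subst (λ x → Separated x (g i)) g0≡0 (g-sep 0F i 0i))
    tip : ∀ a b c → spindleAdj 0F a ≡ true → spindleAdj 0F b ≡ true → spindleAdj a b ≡ true →
          spindleAdj c a ≡ true → spindleAdj c b ≡ true → Near (g c)
    tip a b c 0a 0b ab ca cb =
      rhombusTip-near p<4q (apex a 0a) (apex b 0b) (g-sep a b ab) (g-sep c a ca) (g-sep c b cb)

  spindle-¬pqColouring : 0 < q → 3 * q ≤ p → 2 * p < 7 * q → ¬ PQColouring p q spindle
  spindle-¬pqColouring 0<q 3q≤p 2p<7q pq =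
    let f , f-sep = pqColouring⇒separatedColouring {spindle} q≤p pq
        g , g-sep , g0≡0 = separatedColouring-rotate {spindle} f-sep 0F
    in spindle-¬separatedColouring 0<q p<4q 2p<7q g-sep g0≡0
    where
    q≤p : q ≤ p
    q≤p = ≤-trans (m≤m+n q (2 * q)) 3q≤p
    p<4q : p < 4 * q
    p<4q = *-cancelˡ-< 2 p (4 * q)
             (<-≤-trans 2p<7q (subst (7 * q ≤_) (*-assoc 2 4 q) (*-monoˡ-≤ q (n≤1+n 7))))

mainTheorem5 : (p q : ℕ) → 0 < p → 0 < q →
    3 * q ≤ p → 2 * p < 7 * q →
    Σ Graph λ G → FourCritical G × ¬ PQColouring p q G × (15 * e G + 20 < 27 * v G)
mainTheorem5 p q _ 0<q 3q≤p 2p<7q =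
  spindle ,
  (chromaticNumber {spindle} spindle-4-colourable (¬pq ∘ colourable⇒pqColouring {spindle} 0<q 3q≤p) ,
   properSubgraphs-colourable spindle-noIsolatedVertex spindle-edgeDeletions) ,
  ¬pq ,
  from-yes (15 * e spindle + 20 <? 27 * v spindle)
  where
  ¬pq : ¬ PQColouring p q spindle
  ¬pq = spindle-¬pqColouring 0<q 3q≤p 2p<7q
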